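{- Let $a,b$ be coprime positive integers with $a>1$, and define $f\colon \mathbb{Z}^+\to\mathbb{Z}^+$ by $f(z)=az+b$. There exists $M\in\mathbb{Z}^+$ such that for every $z\in\mathbb{Z}^+$ with $z>M$, not all of the numbers $f(z),f^2(z),\dots$ are prime, and the length $\ell(z)$ of the rooted Cunningham chain with root $z$ satisfies $\ell(z)<z$.
   Context: $f^n$ denotes the $n$-fold iterate of $f$. For a positive integer $z$, the rooted Cunningham chain with root $z$ is the list $\{f(z),f^2(z),\dots,f^{\ell(z)}(z)\}$ where all listed elements are prime and $f^{\ell(z)+1}(z)$ is composite; i.e. $\ell(z)\ge 0$ is the number of consecutive terms $f(z),f^2(z),\dots$ that are prime before the first composite term. Note $z$ itself is not part of the list and need not be prime. -}

module Defs where

open import Data.Nat using (ℕ; zero; suc; _+_; _*_; _≤_; _<_)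
open import Data.Nat.Primality using (Prime)
open import Data.Product using (_×_)
open import Relation.Nullary using (¬_)

affine : ℕ → ℕ → ℕ → ℕ
affine a b z = a * z + b

iter : (ℕ → ℕ) → ℕ → ℕ → ℕ
iter f zero    z = z
iter f (suc n) z = f (iter f n z)

ChainLength : (ℕ → ℕ) → ℕ → ℕ → Set
ChainLength f z ℓ =
  (∀ i → 1 ≤ i → i ≤ ℓ → Prime (iter f i z)) × ¬ Prime (iter f (suc ℓ) z)

-- Write z = u + b S_i, where S_i = 1 + a + ... + a^(i-1), so that
-- f^n(z) = a^n u + b S_(n+i). If q is a prime dividing u but not a, then
-- q ∣ S_p for some period 1 ≤ p ≤ q, and choosing n ≤ p with p ∣ n + i makes
-- q a proper divisor of f^n(z). So if f(z), ..., f^z(z) are all prime, every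
-- prime factor of u_i = z - b S_i divides a. For z large, u_i > a^i for
-- i = 0, ..., a + 1, so each u_i has a prime power r^e ∤ a^i with r ∣ a; by
-- pigeonhole two indices i < j share r. But u_i - u_j = b a^i S_(j-i) with
-- r ∤ b S_(j-i), so the common power of r in u_i and u_j divides a^i: absurd.
module Submission where

open import Data.Empty using (⊥; ⊥-elim)
open import Data.Fin using (Fin; toℕ; fromℕ<)
open import Data.Fin.Properties using (pigeonhole; toℕ-fromℕ<; toℕ<n; fromℕ<-injective)
open import Data.List using ([]; _∷_)
open import Data.List.Relation.Unary.All using (All; []; _∷_)
open import Data.Nat
open import Data.Nat.DivMod using (_%_; _/_; m≡m%n+[m/n]*n; m%n<n)
open import Data.Nat.Divisibility
open import Data.Nat.GCD using (gcd; gcd-greatest)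
open import Data.Nat.ListAction using (product)
open import Data.Nat.Primality
open import Data.Nat.Primality.Factorisation using (factorise)
open import Data.Nat.Properties
open import Data.Nat.Solver using (module +-*-Solver)
open import Data.Product using (Σ; ∃; ∃₂; _×_; _,_; proj₁; proj₂)
open import Data.Sum using (_⊎_; inj₁; inj₂)
open import Function using (_∘_)
open import Relation.Binary.PropositionalEquality
open import Relation.Nullary using (¬_; yes; no)

open import Defs

open +-*-Solver

geomSum : ℕ → ℕ → ℕ
geomSum a zero    = 0
geomSum a (suc n) = 1 + a * geomSum a n

geomSum-+ : ∀ a m n → geomSum a (m + n) ≡ a ^ m * geomSum a n + geomSum a m
geomSum-+ a zero    n = sym (trans (+-identityʳ _) (*-identityˡ _))
geomSum-+ a (suc m) n = trans (cong (λ t → 1 + a * t) (geomSum-+ a m n))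
  (solve 4 (λ a p s t → con 1 :+ a :* (p :* s :+ t) := a :* p :* s :+ (con 1 :+ a :* t))
    refl a (a ^ m) (geomSum a n) (geomSum a m))

geomSum-∸ : ∀ a {i j} → i ≤ j → geomSum a j ≡ a ^ i * geomSum a (j ∸ i) + geomSum a i
geomSum-∸ a {i} {j} i≤j = trans (cong (geomSum a) (sym (m+[n∸m]≡n i≤j))) (geomSum-+ a i (j ∸ i))

geomSum-monoʳ-≤ : ∀ a {m n} → m ≤ n → geomSum a m ≤ geomSum a n
geomSum-monoʳ-≤ a z≤n       = z≤n
geomSum-monoʳ-≤ a (s≤s m≤n) = s≤s (*-monoʳ-≤ a (geomSum-monoʳ-≤ a m≤n))

∣geomSum⇒∣geomSum-multiple : ∀ {d} a {p m} → d ∣ geomSum a p → p ∣ m → d ∣ geomSum a m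
∣geomSum⇒∣geomSum-multiple {d} a     d∣S (divides zero    refl) = d ∣0
∣geomSum⇒∣geomSum-multiple {d} a {p} d∣S (divides (suc k) refl) =
  subst (d ∣_) (sym (geomSum-+ a p (k * p)))
    (∣m∣n⇒∣m+n (∣n⇒∣m*n (a ^ p) (∣geomSum⇒∣geomSum-multiple a d∣S (divides k refl))) d∣S)

iter-affine : ∀ a b n z → iter (affine a b) n z ≡ a ^ n * z + b * geomSum a n
iter-affine a b zero    z = solve 2 (λ z b → z := con 1 :* z :+ b :* con 0) refl z b
iter-affine a b (suc n) z = trans (cong (affine a b) (iter-affine a b n z))
  (solve 5 (λ a b p z s → a :* (p :* z :+ b :* s) :+ b := a :* p :* z :+ b :* (con 1 :+ a :* s))
    refl a b (a ^ n) z (geomSum a n))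

iter-affine-shifted : ∀ a b n {z u i} → z ≡ u + b * geomSum a i →
                      iter (affine a b) n z ≡ a ^ n * u + b * geomSum a (n + i)
iter-affine-shifted a b n {z} {u} {i} refl = begin
  iter (affine a b) n z
    ≡⟨ iter-affine a b n z ⟩
  a ^ n * (u + b * geomSum a i) + b * geomSum a n
    ≡⟨ solve 5 (λ p u b s t → p :* (u :+ b :* s) :+ b :* t := p :* u :+ b :* (p :* s :+ t))
         refl (a ^ n) u b (geomSum a i) (geomSum a n) ⟩
  a ^ n * u + b * (a ^ n * geomSum a i + geomSum a n)
    ≡⟨ cong (λ t → a ^ n * u + b * t) (geomSum-+ a n i) ⟨
  a ^ n * u + b * geomSum a (n + i)
    ∎
  where open ≡-Reasoning

prime∤1 : ∀ {p} → Prime p → ¬ p ∣ 1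
prime∤1 pp p∣1 = ¬prime[1] (subst Prime (∣1⇒≡1 p∣1) pp)

prime∣^⇒∣ : ∀ {p m} n → Prime p → p ∣ m ^ n → p ∣ m
prime∣^⇒∣ zero    pp p∣1 = ⊥-elim (prime∤1 pp p∣1)
prime∣^⇒∣ {m = m} (suc n) pp p∣m^n+1 with euclidsLemma m (m ^ n) pp p∣m^n+1
... | inj₁ p∣m   = p∣m
... | inj₂ p∣m^n = prime∣^⇒∣ n pp p∣m^n

prime∣∧<⇒¬prime : ∀ {p n} → Prime p → p ∣ n → p < n → ¬ Prime n
prime∣∧<⇒¬prime pp p∣n p<n = composite⇒¬prime (composite p<n p∣n)
  where instance _ = prime⇒nonTrivial pp

prime∣prime⇒≡ : ∀ {p q} → Prime p → Prime q → p ∣ q → p ≡ q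
prime∣prime⇒≡ pp pq p∣q with prime⇒irreducible pq p∣q
... | inj₁ refl = ⊥-elim (¬prime[1] pp)
... | inj₂ p≡q  = p≡q

^-monoʳ-∣ : ∀ m {i j} → i ≤ j → m ^ i ∣ m ^ j
^-monoʳ-∣ m {i} {j} i≤j = divides (m ^ (j ∸ i)) (begin
  m ^ j               ≡⟨ cong (m ^_) (sym (m+[n∸m]≡n i≤j)) ⟩
  m ^ (i + (j ∸ i))   ≡⟨ ^-distribˡ-+-* m i (j ∸ i) ⟩
  m ^ i * m ^ (j ∸ i) ≡⟨ *-comm (m ^ i) _ ⟩
  m ^ (j ∸ i) * m ^ i ∎)
  where open ≡-Reasoning

prime^e∣m*n⇒∣m : ∀ {p n} → Prime p → ¬ p ∣ n → ∀ e m → p ^ e ∣ m * n → p ^ e ∣ m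
prime^e∣m*n⇒∣m pp p∤n zero    m _ = 1∣ m
prime^e∣m*n⇒∣m {p} {n} pp p∤n (suc e) m p^e+1∣mn
  with euclidsLemma m n pp (m*n∣⇒m∣ p (p ^ e) p^e+1∣mn)
... | inj₂ p∣n             = ⊥-elim (p∤n p∣n)
... | inj₁ (divides m′ refl) =
  subst (p * p ^ e ∣_) (*-comm p m′) (*-monoʳ-∣ p (prime^e∣m*n⇒∣m pp p∤n e m′ p^e∣m′n))
  where
  instance _ = prime⇒nonZero pp
  p^e∣m′n : p ^ e ∣ m′ * n
  p^e∣m′n = *-cancelˡ-∣ p (subst (p * p ^ e ∣_)
    (solve 3 (λ m p n → m :* p :* n := p :* (m :* n)) refl m′ p n) p^e+1∣mn)

product∤⇒prime-power∣∤ : ∀ {m} ps → All Prime ps → ¬ product ps ∣ m →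
                         ∃₂ λ r e → Prime r × r ^ e ∣ product ps × ¬ r ^ e ∣ m
product∤⇒prime-power∣∤ {m} []       []         ∤m = ⊥-elim (∤m (1∣ m))
product∤⇒prime-power∣∤ {m} (r ∷ ps) (pr ∷ pps) ∤m with r ∣? m
... | no r∤m = r , 1 , pr , subst (_∣ r * product ps) (sym (*-identityʳ r)) (m∣m*n (product ps)) ,
               λ r¹∣m → r∤m (subst (_∣ m) (*-identityʳ r) r¹∣m)
... | yes (divides m′ refl)
  with product∤⇒prime-power∣∤ ps pps
         (λ ps∣m′ → ∤m (subst (r * product ps ∣_) (*-comm r m′) (*-monoʳ-∣ r ps∣m′)))
...   | s , f , ps′ , s^f∣ps , s^f∤m′ with s ≟ r
...     | yes refl = s , suc f , ps′ , *-monoʳ-∣ s s^f∣ps ,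
                     λ s^f+1∣m → s^f∤m′ (*-cancelˡ-∣ s (subst (s * s ^ f ∣_) (*-comm m′ s) s^f+1∣m))
  where instance _ = prime⇒nonZero pr
...     | no s≢r   = s , f , ps′ , ∣-trans s^f∣ps (n∣m*n r) ,
                     λ s^f∣m → s^f∤m′ (prime^e∣m*n⇒∣m ps′ (s≢r ∘ prime∣prime⇒≡ ps′ pr) f m′ s^f∣m)

∤⇒prime-power∣∤ : ∀ {u m} .{{_ : NonZero u}} → ¬ u ∣ m →
                  ∃₂ λ r e → Prime r × r ^ e ∣ u × ¬ r ^ e ∣ m
∤⇒prime-power∣∤ {u} u∤m with factorise u
... | record { factors = ps ; isFactorisation = refl ; factorsPrime = pps } =
  product∤⇒prime-power∣∤ ps pps u∤m

[m+n]%o≡n%o⇒o∣m : ∀ m n o .{{_ : NonZero o}} → (m + n) % o ≡ n % o → o ∣ m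
[m+n]%o≡n%o⇒o∣m m n o eq = ∣m+n∣m⇒∣n (divides ((m + n) / o) (+-cancelˡ-≡ (n % o) _ _ (begin
  n % o + ((n / o) * o + m)   ≡⟨ solve 3 (λ r q m → r :+ (q :+ m) := m :+ (r :+ q)) refl (n % o) ((n / o) * o) m ⟩
  m + (n % o + (n / o) * o)   ≡⟨ cong (m +_) (sym (m≡m%n+[m/n]*n n o)) ⟩
  m + n                       ≡⟨ m≡m%n+[m/n]*n (m + n) o ⟩
  (m + n) % o + (m + n) / o * o ≡⟨ cong (_+ (m + n) / o * o) eq ⟩
  n % o + (m + n) / o * o     ∎)))
  (n∣m*n (n / o))
  where open ≡-Reasoning

%-pigeonhole : ∀ q .{{_ : NonZero q}} (g : ℕ → ℕ) → ∃₂ λ i j → i < j × j ≤ q × g i % q ≡ g j % q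
%-pigeonhole q g with pigeonhole (n<1+n q) (λ k → fromℕ< (m%n<n (g (toℕ k)) q))
... | i , j , i<j , eq = toℕ i , toℕ j , i<j , ≤-pred (toℕ<n j) ,
  trans (sym (toℕ-fromℕ< _)) (trans (cong toℕ eq) (toℕ-fromℕ< _))

prime∤⇒∣geomSum : ∀ {q} a → Prime q → ¬ q ∣ a → ∃ λ p → 1 ≤ p × p ≤ q × q ∣ geomSum a p
prime∤⇒∣geomSum {q} a pq q∤a with %-pigeonhole q {{prime⇒nonZero pq}} (geomSum a)
... | i , j , i<j , j≤q , S[i]≡S[j] = j ∸ i , m<n⇒0<n∸m i<j , ≤-trans (m∸n≤m j i) j≤q , q∣S[j-i]
  where
  instance _ = prime⇒nonZero pq
  q∣S[j-i] : q ∣ geomSum a (j ∸ i)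
  q∣S[j-i] with euclidsLemma (a ^ i) _ pq ([m+n]%o≡n%o⇒o∣m _ _ q
                  (trans (cong (_% q) (sym (geomSum-∸ a (<⇒≤ i<j)))) (sym S[i]≡S[j])))
  ... | inj₁ q∣a^i = ⊥-elim (q∤a (prime∣^⇒∣ i pq q∣a^i))
  ... | inj₂ q∣S   = q∣S

∃-shift-to-multiple : ∀ {p} → 1 ≤ p → ∀ i → ∃ λ n → 1 ≤ n × n ≤ p × p ∣ n + i
∃-shift-to-multiple {p} 1≤p zero = p , 1≤p , ≤-refl , subst (p ∣_) (sym (+-identityʳ p)) ∣-refl
∃-shift-to-multiple {p} 1≤p (suc i) with ∃-shift-to-multiple 1≤p i
... | suc zero    , _ , _   , p∣1+i = p , 1≤p , ≤-refl , ∣m∣n⇒∣m+n ∣-refl p∣1+i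
... | suc (suc n) , _ , n≤p , p∣n+i = suc n , s≤s z≤n , ≤-trans (n≤1+n _) n≤p ,
                                      subst (p ∣_) (sym (+-suc (suc n) i)) p∣n+i

prime∤⇒∣geomSum-shifted : ∀ {q} a → Prime q → ¬ q ∣ a → ∀ i →
                          ∃ λ n → 1 ≤ n × n ≤ q × q ∣ geomSum a (n + i)
prime∤⇒∣geomSum-shifted a pq q∤a i with prime∤⇒∣geomSum a pq q∤a
... | p , 1≤p , p≤q , q∣S[p] with ∃-shift-to-multiple 1≤p i
...   | n , 1≤n , n≤p , p∣n+i =
  n , 1≤n , ≤-trans n≤p p≤q , ∣geomSum⇒∣geomSum-multiple a q∣S[p] p∣n+i

PrimeIterates : (ℕ → ℕ) → ℕ → ℕ → Set
PrimeIterates f z k = ∀ n → 1 ≤ n → n ≤ k → Prime (iter f n z)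

primeIterates⇒prime∣⇒∣a : ∀ {a b z u i q} → 1 < a → PrimeIterates (affine a b) z z →
                          z ≡ u + b * geomSum a i → .{{NonZero u}} → Prime q → q ∣ u → q ∣ a
primeIterates⇒prime∣⇒∣a {a} {b} {z} {u} {i} {q} 1<a primes z≡ pq q∣u with q ∣? a
... | yes q∣a = q∣a
... | no  q∤a with prime∤⇒∣geomSum-shifted a pq q∤a i
...   | n , 1≤n , n≤q , q∣S =
  ⊥-elim (prime∣∧<⇒¬prime pq q∣fⁿz q<fⁿz (primes n 1≤n n≤z))
  where
  fⁿz≡ : iter (affine a b) n z ≡ a ^ n * u + b * geomSum a (n + i)
  fⁿz≡ = iter-affine-shifted a b n z≡
  q∣fⁿz : q ∣ iter (affine a b) n z
  q∣fⁿz = subst (q ∣_) (sym fⁿz≡) (∣m∣n⇒∣m+n (∣n⇒∣m*n (a ^ n) q∣u) (∣n⇒∣m*n b q∣S))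
  q<fⁿz : q < iter (affine a b) n z
  q<fⁿz = begin-strict
    q                                 ≤⟨ ∣⇒≤ q∣u ⟩
    u                                 <⟨ m<m*n u (a ^ n) (^-monoʳ-< a 1<a 1≤n) ⟩
    u * a ^ n                         ≡⟨ *-comm u (a ^ n) ⟩
    a ^ n * u                         ≤⟨ m≤m+n _ _ ⟩
    a ^ n * u + b * geomSum a (n + i) ≡⟨ fⁿz≡ ⟨
    iter (affine a b) n z             ∎
    where open ≤-Reasoning
  n≤z : n ≤ z
  n≤z = ≤-trans n≤q (≤-trans (∣⇒≤ q∣u) (subst (u ≤_) (sym z≡) (m≤m+n u _)))

prime∣a⇒∤b*geomSum : ∀ {r a b k} → Prime r → r ∣ a → gcd a b ≡ 1 → 1 ≤ k → ¬ r ∣ b * geomSum a k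
prime∣a⇒∤b*geomSum {r} {a} {b} {suc k} pr r∣a coprime _ r∣bS
  with euclidsLemma b (geomSum a (suc k)) pr r∣bS
... | inj₁ r∣b = prime∤1 pr (subst (r ∣_) coprime (gcd-greatest r∣a r∣b))
... | inj₂ r∣S = prime∤1 pr (∣m+n∣m⇒∣n (subst (r ∣_) (+-comm 1 _) r∣S) (∣m⇒∣m*n (geomSum a k) r∣a))

bound : ℕ → ℕ → ℕ
bound a b = a ^ suc a + b * geomSum a (suc a)

module LongPrimeIterates {a b z : ℕ} (1<a : 1 < a) (coprime : gcd a b ≡ 1)
  (bound<z : bound a b < z) (primes : PrimeIterates (affine a b) z z) where

  instance
    a≢0 : NonZero a
    a≢0 = >-nonZero (<-trans z<s 1<a)

  u : ℕ → ℕ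
  u i = z ∸ b * geomSum a i

  z≡u+bS : ∀ {i} → i ≤ suc a → z ≡ u i + b * geomSum a i
  z≡u+bS i≤ = sym (m∸n+n≡m
    (≤-trans (*-monoʳ-≤ b (geomSum-monoʳ-≤ a i≤)) (≤-trans (m≤n+m _ _) (<⇒≤ bound<z))))

  a^i<u : ∀ {i} → i ≤ suc a → a ^ i < u i
  a^i<u {i} i≤ = begin-strict
    a ^ i                     ≤⟨ ^-monoʳ-≤ a i≤ ⟩
    a ^ suc a                 <⟨ m+n≤o⇒m≤o∸n (suc (a ^ suc a)) bound<z ⟩
    z ∸ b * geomSum a (suc a) ≤⟨ ∸-monoʳ-≤ z (*-monoʳ-≤ b (geomSum-monoʳ-≤ a i≤)) ⟩
    u i                       ∎
    where open ≤-Reasoning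

  u≢0 : ∀ {i} → i ≤ suc a → NonZero (u i)
  u≢0 i≤ = >-nonZero (≤-<-trans z≤n (a^i<u i≤))

  u∤a^i : ∀ {i} → i ≤ suc a → ¬ u i ∣ a ^ i
  u∤a^i {i} i≤ u∣a^i = <⇒≱ (a^i<u i≤) (∣⇒≤ {{m^n≢0 a i}} u∣a^i)

  u≡u+b*a^i*S : ∀ {i j} → i < j → j ≤ suc a → u i ≡ u j + b * (a ^ i * geomSum a (j ∸ i))
  u≡u+b*a^i*S {i} {j} i<j j≤ = +-cancelʳ-≡ (b * geomSum a i) _ _ (begin
    u i + b * geomSum a i
      ≡⟨ z≡u+bS (≤-trans (<⇒≤ i<j) j≤) ⟨
    z
      ≡⟨ z≡u+bS j≤ ⟩
    u j + b * geomSum a j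
      ≡⟨ cong (λ t → u j + b * t) (geomSum-∸ a (<⇒≤ i<j)) ⟩
    u j + b * (a ^ i * geomSum a (j ∸ i) + geomSum a i)
      ≡⟨ solve 4 (λ v b x s → v :+ b :* (x :+ s) := v :+ b :* x :+ b :* s)
           refl (u j) b (a ^ i * geomSum a (j ∸ i)) (geomSum a i) ⟩
    u j + b * (a ^ i * geomSum a (j ∸ i)) + b * geomSum a i
      ∎)
    where open ≡-Reasoning

  prime-power∣u∧u⇒∣a^i : ∀ {i j r} g → i < j → j ≤ suc a → Prime r → r ∣ a →
                         r ^ g ∣ u i → r ^ g ∣ u j → r ^ g ∣ a ^ i
  prime-power∣u∧u⇒∣a^i {i} {j} {r} g i<j j≤ pr r∣a r^g∣u[i] r^g∣u[j] =
    prime^e∣m*n⇒∣m pr (prime∣a⇒∤b*geomSum pr r∣a coprime (m<n⇒0<n∸m i<j)) g (a ^ i)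
      (subst (r ^ g ∣_)
        (solve 3 (λ b x s → b :* (x :* s) := x :* (b :* s)) refl b (a ^ i) (geomSum a (j ∸ i)))
        (∣m+n∣m⇒∣n (subst (r ^ g ∣_) (u≡u+b*a^i*S i<j j≤) r^g∣u[i]) r^g∣u[j]))

  record ExcessPrimePower (i r : ℕ) : Set where
    field
      r-prime : Prime r
      r∣a     : r ∣ a
      e       : ℕ
      r^e∣u   : r ^ e ∣ u i
      r^e∤a^i : ¬ r ^ e ∣ a ^ i

  open ExcessPrimePower

  excessPrimePower : ∀ {i} → i ≤ suc a → ∃ (ExcessPrimePower i)
  excessPrimePower {i} i≤ with ∤⇒prime-power∣∤ {{u≢0 i≤}} (u∤a^i i≤)
  ... | r , zero  , _  , _     , r⁰∤a^i  = ⊥-elim (r⁰∤a^i (1∣ _))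
  ... | r , suc e , pr , r^e∣u , r^e∤a^i = r , record
    { r-prime = pr
    ; r∣a     = primeIterates⇒prime∣⇒∣a {i = i} 1<a primes (z≡u+bS i≤) {{u≢0 i≤}} pr
                  (∣-trans (m∣m*n (r ^ e)) r^e∣u)
    ; e       = suc e
    ; r^e∣u   = r^e∣u
    ; r^e∤a^i = r^e∤a^i
    }

  no-shared-excess : ∀ {i j r} → i < j → j ≤ suc a → ExcessPrimePower i r → ExcessPrimePower j r → ⊥
  no-shared-excess {i} {j} {r} i<j j≤ E F with e E ≤? e F
  ... | yes e≤f = r^e∤a^i E (prime-power∣u∧u⇒∣a^i (e E) i<j j≤ (r-prime E) (r∣a E)
                    (r^e∣u E) (∣-trans (^-monoʳ-∣ r e≤f) (r^e∣u F)))
  ... | no  e≰f = r^e∤a^i F (∣-trans (prime-power∣u∧u⇒∣a^i (e F) i<j j≤ (r-prime E) (r∣a E)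
                    (∣-trans (^-monoʳ-∣ r (≰⇒≥ e≰f)) (r^e∣u E)) (r^e∣u F)) (^-monoʳ-∣ a (<⇒≤ i<j)))

  excessAt : (k : Fin (2 + a)) → ∃ (ExcessPrimePower (toℕ k))
  excessAt k = excessPrimePower (≤-pred (toℕ<n k))

  absurd : ⊥
  absurd with pigeonhole (n<1+n (suc a)) (λ k → fromℕ< (s≤s (∣⇒≤ (r∣a (proj₂ (excessAt k))))))
  ... | k₁ , k₂ , k₁<k₂ , r₁≡r₂ = no-shared-excess k₁<k₂ (≤-pred (toℕ<n k₂)) (proj₂ (excessAt k₁))
    (subst (ExcessPrimePower (toℕ k₂)) (sym (fromℕ<-injective _ _ _ _ r₁≡r₂)) (proj₂ (excessAt k₂)))

primeIterates⊎chainLength< : ∀ f z k → PrimeIterates f z k ⊎ ∃ λ ℓ → ChainLength f z ℓ × ℓ < k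
primeIterates⊎chainLength< f z zero = inj₁ λ n 1≤n n≤0 → ⊥-elim (<⇒≱ 1≤n n≤0)
primeIterates⊎chainLength< f z (suc k) with primeIterates⊎chainLength< f z k
... | inj₂ (ℓ , chain , ℓ<k) = inj₂ (ℓ , chain , m<n⇒m<1+n ℓ<k)
... | inj₁ primes with prime? (iter f (suc k) z)
...   | no  ¬prime = inj₂ (k , (primes , ¬prime) , n<1+n k)
...   | yes prime[k+1] = inj₁ extended
  where
  extended : PrimeIterates f z (suc k)
  extended n 1≤n n≤k+1 with m≤n⇒m<n∨m≡n n≤k+1
  ... | inj₁ n<k+1 = primes n 1≤n (≤-pred n<k+1)
  ... | inj₂ refl  = prime[k+1]

chainLength⇒¬prime-iterates : ∀ {f z ℓ} → ChainLength f z ℓ → ¬ (∀ n → 1 ≤ n → Prime (iter f n z))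
chainLength⇒¬prime-iterates {ℓ = ℓ} (_ , ¬prime) primes = ¬prime (primes (suc ℓ) (s≤s z≤n))

theorem2 : (a b : ℕ) → 0 < b → 1 < a → gcd a b ≡ 1 →
    Σ ℕ (λ M → 0 < M × (∀ z → M < z →
    ¬ (∀ n → 1 ≤ n → Prime (iter (affine a b) n z))
    × ∃ (λ ℓ → ChainLength (affine a b) z ℓ × ℓ < z)))
theorem2 a b _ 1<a coprime = bound a b , ≤-trans (m^n>0 a (suc a)) (m≤m+n _ _) , λ z bound<z →
  chainLength⇒¬prime-iterates (proj₁ (proj₂ (chain z bound<z))) , chain z bound<z
  where
  instance _ = >-nonZero (<-trans z<s 1<a)
  chain : ∀ z → bound a b < z → ∃ λ ℓ → ChainLength (affine a b) z ℓ × ℓ < z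
  chain z bound<z with primeIterates⊎chainLength< (affine a b) z z
  ... | inj₁ primes = ⊥-elim (LongPrimeIterates.absurd 1<a coprime bound<z primes)
  ... | inj₂ short  = short
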